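{- Let $k\ge2$. For all integers $a,b$, $\Phi_{3^k}(a,b)\equiv 0,1$ or $3\pmod 9$.
   Context: $\Phi_n(X,Y)=Y^{\varphi(n)}\phi_n(X/Y)$, with $\phi_n$ the $n$-th cyclotomic polynomial; in particular $\Phi_{3^k}(X,Y)=X^{2\cdot3^{k-1}}+X^{3^{k-1}}Y^{3^{k-1}}+Y^{2\cdot 3^{k-1}}$. -}

module Defs where

open import Data.Nat as ℕ using (ℕ; _∸_)
open import Data.Integer using (ℤ; _+_; _*_; _^_)

-- Homogenised cyclotomic polynomial Φ_{3^k}(X,Y) = Y^{φ(3^k)} φ_{3^k}(X/Y), for k ≥ 1:
--   Φ_{3^k}(X,Y) = X^{2·3^{k-1}} + X^{3^{k-1}} Y^{3^{k-1}} + Y^{2·3^{k-1}}.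
-- (The formula is only meaningful for k ≥ 1; the statement assumes k ≥ 2.)
Φ3^ : ℕ → ℤ → ℤ → ℤ
Φ3^ k a b = a ^ (2 ℕ.* m) + (a ^ m) * (b ^ m) + b ^ (2 ℕ.* m)
  where m = 3 ℕ.^ (k ∸ 1)

module Submission where

-- Put m = 3^(k-1), A = a^m and B = b^m, so that
-- Φ_{3^k}(a,b) = A² + AB + B².  Since k ≥ 2, m is a multiple of 3, hence A
-- and B are cubes, and every cube is congruent to 0, 1 or -1 modulo 9.
-- Congruence modulo 9 respects sums and products, so Φ_{3^k}(a,b) is
-- congruent to c² + cd + d² for some c, d ∈ {0, 1, -1}; these nine values
-- are 0, 1 or 3.  Finally a value t < 9 congruent to x is the remainder
-- x %ℕ 9, which gives the claim.

open import Defs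
open import Data.Nat as ℕ using (ℕ; zero; suc; _≤_; s≤s; z≤n)
import Data.Nat.Properties as ℕ
open import Data.Nat.DivMod as ℕ using (m<n⇒m%n≡m)
open import Data.Nat.Divisibility as ℕ using (n∣m⇒m%n≡0)
open import Data.Integer as ℤ using (ℤ; +_; 0ℤ; 1ℤ; -1ℤ; _+_; _*_; _-_; -_; _^_; ∣_∣)
import Data.Integer.Properties as ℤ
open import Data.Integer.DivMod using (_%ℕ_; _/ℕ_; a≡a%ℕn+[a/ℕn]*n; n%ℕd<d)
open import Data.Integer.Divisibility.Signed
  using (_∣_; divides; ∣m∣n⇒∣m+n; ∣m⇒∣-m; ∣m⇒∣m*n; ∣n⇒∣m*n; ∣⇒∣ᵤ)
open import Data.Integer.Tactic.RingSolver using (solve-∀)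
open import Data.Product using (∃-syntax; _×_; _,_)
open import Data.Sum using (_⊎_; inj₁; inj₂)
open import Relation.Binary.PropositionalEquality
  using (_≡_; refl; sym; trans; cong; cong₂; subst; module ≡-Reasoning)

-- Congruence of integers modulo a natural number n: n divides x - y.
-- (A record rather than a definition, so that x and y can be inferred.)
infix 4 _≡_mod_
record _≡_mod_ (x y : ℤ) (n : ℕ) : Set where
  constructor mod-by
  field divides-difference : + n ∣ x - y

module _ {n : ℕ} where

  mod-refl : ∀ x → x ≡ x mod n
  mod-refl x = mod-by (divides 0ℤ (ℤ.+-inverseʳ x))

  mod-sym : ∀ {x y} → x ≡ y mod n → y ≡ x mod n
  mod-sym {x} {y} (mod-by n∣x-y) = mod-by (subst (+ n ∣_) (negate x y) (∣m⇒∣-m n∣x-y))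
    where
    negate : ∀ x y → - (x - y) ≡ y - x
    negate = solve-∀

  mod-trans : ∀ {x y z} → x ≡ y mod n → y ≡ z mod n → x ≡ z mod n
  mod-trans {x} {y} {z} (mod-by n∣x-y) (mod-by n∣y-z) =
    mod-by (subst (+ n ∣_) (telescope x y z) (∣m∣n⇒∣m+n n∣x-y n∣y-z))
    where
    telescope : ∀ x y z → (x - y) + (y - z) ≡ x - z
    telescope = solve-∀

  mod-reflexive : ∀ {x y} → x ≡ y → x ≡ y mod n
  mod-reflexive {x} refl = mod-refl x

  +-cong : ∀ {x x′ y y′} → x ≡ x′ mod n → y ≡ y′ mod n → x + y ≡ x′ + y′ mod n
  +-cong {x} {x′} {y} {y′} (mod-by n∣dx) (mod-by n∣dy) =
    mod-by (subst (+ n ∣_) (regroup x x′ y y′) (∣m∣n⇒∣m+n n∣dx n∣dy))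
    where
    regroup : ∀ x x′ y y′ → (x - x′) + (y - y′) ≡ (x + y) - (x′ + y′)
    regroup = solve-∀

  *-cong : ∀ {x x′ y y′} → x ≡ x′ mod n → y ≡ y′ mod n → x * y ≡ x′ * y′ mod n
  *-cong {x} {x′} {y} {y′} (mod-by n∣dx) (mod-by n∣dy) =
    mod-by (subst (+ n ∣_) (regroup x x′ y y′) (∣m∣n⇒∣m+n (∣m⇒∣m*n y n∣dx) (∣n⇒∣m*n x′ n∣dy)))
    where
    regroup : ∀ x x′ y y′ → (x - x′) * y + x′ * (y - y′) ≡ x * y - x′ * y′
    regroup = solve-∀

  ^-cong : ∀ {x y} e → x ≡ y mod n → x ^ e ≡ y ^ e mod n
  ^-cong zero    _   = mod-refl 1ℤ
  ^-cong (suc e) x≡y = *-cong x≡y (^-cong e x≡y)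

module _ {n : ℕ} .{{_ : ℕ.NonZero n}} where

  mod-%ℕ : ∀ x → x ≡ + (x %ℕ n) mod n
  mod-%ℕ x = mod-by (divides (x /ℕ n) (begin
    x - + (x %ℕ n)                             ≡⟨ cong (_- + (x %ℕ n)) (a≡a%ℕn+[a/ℕn]*n x n) ⟩
    + (x %ℕ n) + (x /ℕ n) * + n - + (x %ℕ n)   ≡⟨ cancel (+ (x %ℕ n)) ((x /ℕ n) * + n) ⟩
    (x /ℕ n) * + n                             ∎))
    where
    open ≡-Reasoning
    cancel : ∀ r t → r + t - r ≡ t
    cancel = solve-∀

  -- Distinct naturals below n are incongruent: their difference is
  -- divisible by n yet smaller than n in absolute value.
  residues-unique : ∀ {r s} → r ℕ.< n → s ℕ.< n → + r ≡ + s mod n → r ≡ s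
  residues-unique {r} {s} r<n s<n (mod-by n∣r-s) =
    ℤ.+-injective (ℤ.i-j≡0⇒i≡j (+ r) (+ s) (ℤ.∣i∣≡0⇒i≡0 ∣r-s∣≡0))
    where
    ∣r-s∣<n : ∣ + r - + s ∣ ℕ.< n
    ∣r-s∣<n = subst (ℕ._< n) (cong ∣_∣ (sym (ℤ.m-n≡m⊖n r s)))
                (ℕ.≤-<-trans (ℤ.∣m⊝n∣≤m⊔n r s) (ℕ.⊔-lub r<n s<n))
    ∣r-s∣≡0 : ∣ + r - + s ∣ ≡ 0
    ∣r-s∣≡0 = trans (sym (m<n⇒m%n≡m ∣r-s∣<n)) (n∣m⇒m%n≡0 _ n (∣⇒∣ᵤ n∣r-s))

  %ℕ-unique : ∀ {x r} → r ℕ.< n → x ≡ + r mod n → x %ℕ n ≡ r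
  %ℕ-unique {x} r<n x≡r = residues-unique (n%ℕd<d x n) r<n (mod-trans (mod-sym (mod-%ℕ x)) x≡r)

CubeResidue : ℤ → Set
CubeResidue c = c ≡ 0ℤ ⊎ c ≡ 1ℤ ⊎ c ≡ -1ℤ

-- The cubes of 0, 1, ..., 8 are 0, 1, 8, 27, 64, 125, 216, 343, 512.
cube-of-small-mod-9 : ∀ r → r ℕ.< 9 → ∃[ c ] CubeResidue c × (+ r) ^ 3 ≡ c mod 9
cube-of-small-mod-9 0 _ = 0ℤ  , inj₁ refl        , mod-by (divides (+ 0)  refl)
cube-of-small-mod-9 1 _ = 1ℤ  , inj₂ (inj₁ refl) , mod-by (divides (+ 0)  refl)
cube-of-small-mod-9 2 _ = -1ℤ , inj₂ (inj₂ refl) , mod-by (divides (+ 1)  refl)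
cube-of-small-mod-9 3 _ = 0ℤ  , inj₁ refl        , mod-by (divides (+ 3)  refl)
cube-of-small-mod-9 4 _ = 1ℤ  , inj₂ (inj₁ refl) , mod-by (divides (+ 7)  refl)
cube-of-small-mod-9 5 _ = -1ℤ , inj₂ (inj₂ refl) , mod-by (divides (+ 14) refl)
cube-of-small-mod-9 6 _ = 0ℤ  , inj₁ refl        , mod-by (divides (+ 24) refl)
cube-of-small-mod-9 7 _ = 1ℤ  , inj₂ (inj₁ refl) , mod-by (divides (+ 38) refl)
cube-of-small-mod-9 8 _ = -1ℤ , inj₂ (inj₂ refl) , mod-by (divides (+ 57) refl)
cube-of-small-mod-9 (suc (suc (suc (suc (suc (suc (suc (suc (suc _)))))))))
  (s≤s (s≤s (s≤s (s≤s (s≤s (s≤s (s≤s (s≤s (s≤s ())))))))))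

cube-mod-9 : ∀ x → ∃[ c ] CubeResidue c × x ^ 3 ≡ c mod 9
cube-mod-9 x =
  let c , c-res , r³≡c = cube-of-small-mod-9 (x %ℕ 9) (n%ℕd<d x 9)
  in c , c-res , mod-trans (^-cong 3 (mod-%ℕ x)) r³≡c

^-3^suc : ∀ x j → x ^ (3 ℕ.^ suc j) ≡ (x ^ (3 ℕ.^ j)) ^ 3
^-3^suc x j = begin
  x ^ (3 ℕ.* 3 ℕ.^ j)   ≡⟨ cong (x ^_) (ℕ.*-comm 3 (3 ℕ.^ j)) ⟩
  x ^ (3 ℕ.^ j ℕ.* 3)   ≡⟨ ℤ.^-*-assoc x (3 ℕ.^ j) 3 ⟨
  (x ^ (3 ℕ.^ j)) ^ 3   ∎
  where open ≡-Reasoning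

Q : ℤ → ℤ → ℤ
Q x y = x * x + x * y + y * y

Q-cong : ∀ {n x x′ y y′} → x ≡ x′ mod n → y ≡ y′ mod n → Q x y ≡ Q x′ y′ mod n
Q-cong x≡x′ y≡y′ = +-cong (+-cong (*-cong x≡x′ x≡x′) (*-cong x≡x′ y≡y′)) (*-cong y≡y′ y≡y′)

Φ3^-as-Q : ∀ k a b → Φ3^ k a b ≡ Q (a ^ (3 ℕ.^ (k ℕ.∸ 1))) (b ^ (3 ℕ.^ (k ℕ.∸ 1)))
Φ3^-as-Q k a b = cong₂ (λ p q → p + (a ^ m) * (b ^ m) + q) (^-double a) (^-double b)
  where
  m = 3 ℕ.^ (k ℕ.∸ 1)
  ^-double : ∀ x → x ^ (2 ℕ.* m) ≡ x ^ m * x ^ m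
  ^-double x = trans (ℤ.^-distribˡ-+-* x m (m ℕ.+ 0)) (cong (λ e → x ^ m * x ^ e) (ℕ.+-identityʳ m))

ZeroOneOrThree : ℕ → Set
ZeroOneOrThree t = t ≡ 0 ⊎ t ≡ 1 ⊎ t ≡ 3

ZeroOneOrThree⇒<9 : ∀ {t} → ZeroOneOrThree t → t ℕ.< 9
ZeroOneOrThree⇒<9 (inj₁ refl)        = s≤s z≤n
ZeroOneOrThree⇒<9 (inj₂ (inj₁ refl)) = s≤s (s≤s z≤n)
ZeroOneOrThree⇒<9 (inj₂ (inj₂ refl)) = s≤s (s≤s (s≤s (s≤s z≤n)))

Q-on-cube-residues : ∀ {c d} → CubeResidue c → CubeResidue d → ∃[ t ] Q c d ≡ + t × ZeroOneOrThree t
Q-on-cube-residues (inj₁ refl)        (inj₁ refl)        = 0 , refl , inj₁ refl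
Q-on-cube-residues (inj₁ refl)        (inj₂ (inj₁ refl)) = 1 , refl , inj₂ (inj₁ refl)
Q-on-cube-residues (inj₁ refl)        (inj₂ (inj₂ refl)) = 1 , refl , inj₂ (inj₁ refl)
Q-on-cube-residues (inj₂ (inj₁ refl)) (inj₁ refl)        = 1 , refl , inj₂ (inj₁ refl)
Q-on-cube-residues (inj₂ (inj₁ refl)) (inj₂ (inj₁ refl)) = 3 , refl , inj₂ (inj₂ refl)
Q-on-cube-residues (inj₂ (inj₁ refl)) (inj₂ (inj₂ refl)) = 1 , refl , inj₂ (inj₁ refl)
Q-on-cube-residues (inj₂ (inj₂ refl)) (inj₁ refl)        = 1 , refl , inj₂ (inj₁ refl)
Q-on-cube-residues (inj₂ (inj₂ refl)) (inj₂ (inj₁ refl)) = 1 , refl , inj₂ (inj₁ refl)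
Q-on-cube-residues (inj₂ (inj₂ refl)) (inj₂ (inj₂ refl)) = 3 , refl , inj₂ (inj₂ refl)

Φ3^-mod-9 : ∀ j a b → ∃[ t ] Φ3^ (suc (suc j)) a b ≡ + t mod 9 × ZeroOneOrThree t
Φ3^-mod-9 j a b =
  let c , c-res , A≡c = cube-mod-9 (a ^ (3 ℕ.^ j))
      d , d-res , B≡d = cube-mod-9 (b ^ (3 ℕ.^ j))
      t , Qcd≡t , t-ok = Q-on-cube-residues c-res d-res
      A≡c′ = subst (_≡ c mod 9) (sym (^-3^suc a j)) A≡c
      B≡d′ = subst (_≡ d mod 9) (sym (^-3^suc b j)) B≡d
  in t , mod-trans (mod-reflexive (Φ3^-as-Q (suc (suc j)) a b))
                   (mod-trans (Q-cong A≡c′ B≡d′) (mod-reflexive Qcd≡t))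
       , t-ok

proposition4p4 : (k : ℕ) → 2 ≤ k → (a b : ℤ) →
    (Φ3^ k a b %ℕ 9 ≡ 0) ⊎ (Φ3^ k a b %ℕ 9 ≡ 1) ⊎ (Φ3^ k a b %ℕ 9 ≡ 3)
proposition4p4 (suc (suc j)) (s≤s (s≤s z≤n)) a b =
  let t , Φ≡t , t-ok = Φ3^-mod-9 j a b
  in subst ZeroOneOrThree (sym (%ℕ-unique (ZeroOneOrThree⇒<9 t-ok) Φ≡t)) t-ok
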